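{- Let $L_+,L_-$ be frames and $R\subseteq L_+\times L_-$. Then: (1) if $R$ is closed under logical $\wedge$ and $\vee$, then $\downarrow R$ and $\uparrow R$ are closed under logical $\wedge$ and $\vee$; (2) if $R$ is closed under logical $\wedge$ and $\vee$, then $\mathcal D(R)$ is closed under logical $\wedge$ and $\vee$; (3) if $R$ is $\sqsubseteq$-downward closed, then $\mathcal D(R)$ is $\sqsubseteq$-downward closed.
   Context: On $L_+\times L_-$: information order $\alpha\sqsubseteq\beta$ iff $\alpha_+\le\beta_+$ and $\alpha_-\le\beta_-$; logical join $\alpha\vee\beta=(\alpha_+\vee\beta_+,\alpha_-\wedge\beta_-)$ and logical meet $\alpha\wedge\beta=(\alpha_+\wedge\beta_+,\alpha_-\vee\beta_-)$. $\downarrow R=\{\alpha:\exists\beta\in R,\alpha\sqsubseteq\beta\}$, $\uparrow R=\{\alpha:\exists\beta\in R,\beta\sqsubseteq\alpha\}$. $\mathcal D(R)=\{\bigsqcup A: A\subseteq R\text{ is }\sqsubseteq\text{ -directed}\}$ with $\bigsqcup A=(\bigvee_{\alpha\in A}\alpha_+,\bigvee_{\alpha\in A}\alpha_-)$. -}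

module Defs where

open import Level using (Level; suc; zero; _⊔_)
open import Data.Bool using (Bool; true; false)
open import Data.Product using (Σ; ∃; _×_; _,_; proj₁; proj₂)
open import Relation.Binary.PropositionalEquality using (_≡_)
open import Relation.Binary.Structures using (IsPartialOrder)
open import Relation.Unary using (Pred; _⊆_)

record Frame : Set₁ where
  infixr 7 _∧_
  infix 4 _≤_
  field
    Carrier        : Set
    _≤_            : Carrier → Carrier → Set
    isPartialOrder : IsPartialOrder _≡_ _≤_
    _∧_            : Carrier → Carrier → Carrier
    ∧-lb₁          : ∀ a b → a ∧ b ≤ a
    ∧-lb₂          : ∀ a b → a ∧ b ≤ b
    ∧-glb          : ∀ a b c → c ≤ a → c ≤ b → c ≤ a ∧ b
    ⋁              : {I : Set} → (I → Carrier) → Carrier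
    ⋁-ub           : {I : Set} (f : I → Carrier) (i : I) → f i ≤ ⋁ f
    ⋁-lub          : {I : Set} (f : I → Carrier) (c : Carrier) →
                     (∀ i → f i ≤ c) → ⋁ f ≤ c
    distrib        : {I : Set} (a : Carrier) (f : I → Carrier) →
                     a ∧ ⋁ f ≡ ⋁ (λ i → a ∧ f i)

  infixr 6 _∨_
  _∨_ : Carrier → Carrier → Carrier
  a ∨ b = ⋁ {Bool} (λ { true → a ; false → b })

module Bilattice (L₊ L₋ : Frame) where
  private
    module P = Frame L₊
    module N = Frame L₋

  Pair : Set
  Pair = P.Carrier × N.Carrier

  infix 4 _⊑_
  _⊑_ : Pair → Pair → Set
  α ⊑ β = (proj₁ α P.≤ proj₁ β) × (proj₂ α N.≤ proj₂ β)

  _⋎_ : Pair → Pair → Pair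
  α ⋎ β = (proj₁ α P.∨ proj₁ β) , (proj₂ α N.∧ proj₂ β)

  _⋏_ : Pair → Pair → Pair
  α ⋏ β = (proj₁ α P.∧ proj₁ β) , (proj₂ α N.∨ proj₂ β)

  ↓_ : ∀ {ℓ} → Pred Pair ℓ → Pred Pair ℓ
  ↓ R = λ α → ∃ λ β → R β × α ⊑ β

  ↑_ : ∀ {ℓ} → Pred Pair ℓ → Pred Pair ℓ
  ↑ R = λ α → ∃ λ β → R β × β ⊑ α

  Directed : Pred Pair zero → Set
  Directed A = (∃ λ α → A α) ×
               (∀ α β → A α → A β → ∃ λ γ → A γ × α ⊑ γ × β ⊑ γ)

  ⨆ : Pred Pair zero → Pair
  ⨆ A = P.⋁ {Σ Pair A} (λ x → proj₁ (proj₁ x)) ,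
        N.⋁ {Σ Pair A} (λ x → proj₂ (proj₁ x))

  𝒟 : Pred Pair zero → Pred Pair (suc zero)
  𝒟 R = λ α → ∃ λ (A : Pred Pair zero) → A ⊆ R × Directed A × α ≡ ⨆ A

  LogicClosed : ∀ {ℓ} → Pred Pair ℓ → Set ℓ
  LogicClosed R = ∀ α β → R α → R β → R (α ⋏ β) × R (α ⋎ β)

  DownClosed : ∀ {ℓ} → Pred Pair ℓ → Set ℓ
  DownClosed R = ∀ α β → α ⊑ β → R β → R α

-- In a frame both binary meet and binary join distribute over joins of
-- nonempty families, hence so do the logical operations ⋏ and ⋎ of L₊ × L₋:
-- ⨆ A ⋏ ⨆ B is the join of the family a ⋏ b (a ∈ A, b ∈ B), which is directed
-- when A and B are, because ⋏ is ⊑-monotone. Likewise, if α ⊑ ⨆ A then by the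
-- frame law α is the join of the directed family γ ⊓ α (γ ∈ A), whose members
-- lie below members of A.
module Submission where

open import Defs
open import Data.Product using (_×_; Σ; ∃; _,_; proj₁; proj₂)
open import Relation.Unary using (Pred)
open import Level using (zero)

open import Data.Bool using (true; false)
open import Function using (_∘_)
open import Relation.Binary.Core using (_Preserves_⟶_; _Preserves₂_⟶_⟶_)
open import Relation.Binary.Lattice.Structures using (IsMeetSemilattice; IsJoinSemilattice)
open import Relation.Binary.Lattice.Bundles using (MeetSemilattice; JoinSemilattice)
open import Relation.Binary.PropositionalEquality using (_≡_; refl; sym; cong₂; subst)
import Relation.Binary.Lattice.Properties.MeetSemilattice as MeetSemilatticeProperties
import Relation.Binary.Lattice.Properties.JoinSemilattice as JoinSemilatticeProperties
import Relation.Binary.Reasoning.PartialOrder as PartialOrderReasoning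

module FrameProperties (F : Frame) where
  open Frame F public

  isMeetSemilattice : IsMeetSemilattice _≡_ _≤_ _∧_
  isMeetSemilattice = record
    { isPartialOrder = isPartialOrder
    ; infimum        = λ a b → ∧-lb₁ a b , ∧-lb₂ a b , λ c → ∧-glb a b c
    }

  isJoinSemilattice : IsJoinSemilattice _≡_ _≤_ _∨_
  isJoinSemilattice = record
    { isPartialOrder = isPartialOrder
    ; supremum       = λ a b → ⋁-ub _ true , ⋁-ub _ false ,
                               λ c p q → ⋁-lub _ c λ { true → p ; false → q }
    }

  meetSemilattice : MeetSemilattice _ _ _
  meetSemilattice = record { isMeetSemilattice = isMeetSemilattice }

  joinSemilattice : JoinSemilattice _ _ _
  joinSemilattice = record { isJoinSemilattice = isJoinSemilattice }

  open IsMeetSemilattice isMeetSemilattice public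
    using (x∧y≤x; x∧y≤y; ∧-greatest; antisym; reflexive)
    renaming (refl to ≤-refl; trans to ≤-trans)
  open IsJoinSemilattice isJoinSemilattice public using (x≤x∨y; y≤x∨y; ∨-least)
  open MeetSemilatticeProperties meetSemilattice public using (∧-comm; ∧-monotonic)
  open JoinSemilatticeProperties joinSemilattice public using (∨-monotonic)
  open PartialOrderReasoning (MeetSemilattice.poset meetSemilattice)

  module _ {I : Set} (f : I → Carrier) where

    ∧-⋁-least : ∀ {a c} → (∀ i → a ∧ f i ≤ c) → a ∧ ⋁ f ≤ c
    ∧-⋁-least {a} {c} h = begin
      a ∧ ⋁ f              ≡⟨ distrib a f ⟩
      ⋁ (λ i → a ∧ f i)    ≤⟨ ⋁-lub _ c h ⟩
      c                    ∎

    ⋁-∧-least : ∀ {a c} → (∀ i → f i ∧ a ≤ c) → ⋁ f ∧ a ≤ c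
    ⋁-∧-least {a} {c} h = begin
      ⋁ f ∧ a   ≡⟨ ∧-comm (⋁ f) a ⟩
      a ∧ ⋁ f   ≤⟨ ∧-⋁-least (λ i → ≤-trans (reflexive (∧-comm a (f i))) (h i)) ⟩
      c         ∎

    ⋁-cofinal : {J : Set} {g : J → Carrier} →
                (∀ i → ∃ λ j → f i ≤ g j) → ⋁ f ≤ ⋁ g
    ⋁-cofinal {g = g} h = ⋁-lub f (⋁ g) λ i →
      let (j , fi≤gj) = h i in ≤-trans fi≤gj (⋁-ub g j)

    ≤⋁⇒≡⋁-∧ : ∀ {a} → a ≤ ⋁ f → a ≡ ⋁ (λ i → f i ∧ a)
    ≤⋁⇒≡⋁-∧ {a} a≤⋁f = antisym
      (begin
        a         ≤⟨ ∧-greatest a≤⋁f ≤-refl ⟩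
        ⋁ f ∧ a   ≤⟨ ⋁-∧-least (⋁-ub (λ i → f i ∧ a)) ⟩
        ⋁ (λ i → f i ∧ a) ∎)
      (⋁-lub _ a λ i → x∧y≤y (f i) a)

  module _ {I J : Set} (f : I → Carrier) (g : J → Carrier) where

    ⋁-∧-⋁ : ⋁ f ∧ ⋁ g ≡ ⋁ (λ (ij : I × J) → f (proj₁ ij) ∧ g (proj₂ ij))
    ⋁-∧-⋁ = antisym
      (∧-⋁-least g λ j → ⋁-∧-least f λ i → ⋁-ub _ (i , j))
      (⋁-lub _ _ λ (i , j) → ∧-monotonic (⋁-ub f i) (⋁-ub g j))

    ⋁-∨-⋁ : I → J → ⋁ f ∨ ⋁ g ≡ ⋁ (λ (ij : I × J) → f (proj₁ ij) ∨ g (proj₂ ij))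
    ⋁-∨-⋁ i₀ j₀ = antisym
      (∨-least (⋁-cofinal f λ i → (i , j₀) , x≤x∨y (f i) (g j₀))
               (⋁-cofinal g λ j → (i₀ , j) , y≤x∨y (f i₀) (g j)))
      (⋁-lub _ _ λ (i , j) → ∨-monotonic (⋁-ub f i) (⋁-ub g j))

module BilatticeProperties (L₊ L₋ : Frame) where
  open Bilattice L₊ L₋
  private
    module P = FrameProperties L₊
    module N = FrameProperties L₋

  ⊑-refl : ∀ {α} → α ⊑ α
  ⊑-refl = P.≤-refl , N.≤-refl

  ⊑-antisym : ∀ {α β} → α ⊑ β → β ⊑ α → α ≡ β
  ⊑-antisym (p₊ , p₋) (q₊ , q₋) = cong₂ _,_ (P.antisym p₊ q₊) (N.antisym p₋ q₋)

  ⋏-monotonic : _⋏_ Preserves₂ _⊑_ ⟶ _⊑_ ⟶ _⊑_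
  ⋏-monotonic (p₊ , p₋) (q₊ , q₋) = P.∧-monotonic p₊ q₊ , N.∨-monotonic p₋ q₋

  ⋎-monotonic : _⋎_ Preserves₂ _⊑_ ⟶ _⊑_ ⟶ _⊑_
  ⋎-monotonic (p₊ , p₋) (q₊ , q₋) = P.∨-monotonic p₊ q₊ , N.∧-monotonic p₋ q₋

  infixr 7 _⊓_
  _⊓_ : Pair → Pair → Pair
  α ⊓ β = proj₁ α P.∧ proj₁ β , proj₂ α N.∧ proj₂ β

  ⊓-monotonicˡ : ∀ β → (_⊓ β) Preserves _⊑_ ⟶ _⊑_
  ⊓-monotonicˡ β (p₊ , p₋) = P.∧-monotonic p₊ P.≤-refl , N.∧-monotonic p₋ N.≤-refl

  α⊓β⊑α : ∀ α β → α ⊓ β ⊑ α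
  α⊓β⊑α α β = P.x∧y≤x _ _ , N.x∧y≤x _ _

  ClosedUnder : ∀ {ℓ} → (Pair → Pair → Pair) → Pred Pair ℓ → Set ℓ
  ClosedUnder _∙_ R = ∀ α β → R α → R β → R (α ∙ β)

  ↓-closedUnder : ∀ {_∙_} → _∙_ Preserves₂ _⊑_ ⟶ _⊑_ ⟶ _⊑_ →
                  ∀ {R : Pred Pair zero} → ClosedUnder _∙_ R → ClosedUnder _∙_ (↓ R)
  ↓-closedUnder mono closed _ _ (α' , Rα' , α⊑α') (β' , Rβ' , β⊑β') =
    _ , closed α' β' Rα' Rβ' , mono α⊑α' β⊑β'

  ↑-closedUnder : ∀ {_∙_} → _∙_ Preserves₂ _⊑_ ⟶ _⊑_ ⟶ _⊑_ →
                  ∀ {R : Pred Pair zero} → ClosedUnder _∙_ R → ClosedUnder _∙_ (↑ R)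
  ↑-closedUnder mono closed _ _ (α' , Rα' , α'⊑α) (β' , Rβ' , β'⊑β) =
    _ , closed α' β' Rα' Rβ' , mono α'⊑α β'⊑β

  -- ⨆ A is definitionally ⨆ᶠ {Σ Pair A} proj₁
  ⨆ᶠ : {I : Set} → (I → Pair) → Pair
  ⨆ᶠ f = P.⋁ (proj₁ ∘ f) , N.⋁ (proj₂ ∘ f)

  ⨆ᶠ-cofinal : {I J : Set} {f : I → Pair} {g : J → Pair} →
               (∀ i → ∃ λ j → f i ⊑ g j) → ⨆ᶠ f ⊑ ⨆ᶠ g
  ⨆ᶠ-cofinal h = P.⋁-cofinal _ (λ i → let (j , p , _) = h i in j , p)
               , N.⋁-cofinal _ (λ i → let (j , _ , q) = h i in j , q)

  range : {I : Set} → (I → Pair) → Pred Pair zero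
  range f α = ∃ λ i → α ≡ f i

  ⨆-range : {I : Set} (f : I → Pair) → ⨆ (range f) ≡ ⨆ᶠ f
  ⨆-range f = ⊑-antisym
    (⨆ᶠ-cofinal λ { (_ , i , refl) → i , ⊑-refl })
    (⨆ᶠ-cofinal λ i → (f i , i , refl) , ⊑-refl)

  DirectedFamily : {I : Set} → (I → Pair) → Set
  DirectedFamily {I} f = I × (∀ i j → ∃ λ k → f i ⊑ f k × f j ⊑ f k)

  Directed⇒DirectedFamily : ∀ {A} → Directed A → DirectedFamily {Σ Pair A} proj₁
  Directed⇒DirectedFamily (inhabited , bounded) =
    inhabited , λ (α , Aα) (β , Aβ) →
      let (γ , Aγ , α⊑γ , β⊑γ) = bounded α β Aα Aβ in (γ , Aγ) , α⊑γ , β⊑γ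

  range-directed : {I : Set} {f : I → Pair} → DirectedFamily f → Directed (range f)
  range-directed {f = f} (i₀ , bounded) =
    (f i₀ , i₀ , refl) , λ { _ _ (i , refl) (j , refl) →
      let (k , fi⊑fk , fj⊑fk) = bounded i j in f k , (k , refl) , fi⊑fk , fj⊑fk }

  DirectedFamily-map : {I : Set} {f : I → Pair} {h : Pair → Pair} →
                       h Preserves _⊑_ ⟶ _⊑_ →
                       DirectedFamily f → DirectedFamily (h ∘ f)
  DirectedFamily-map mono (i₀ , bounded) =
    i₀ , λ i j → let (k , fi⊑fk , fj⊑fk) = bounded i j in k , mono fi⊑fk , mono fj⊑fk

  DirectedFamily-zipWith : {I J : Set} {f : I → Pair} {g : J → Pair} {_∙_ : Pair → Pair → Pair} →
    _∙_ Preserves₂ _⊑_ ⟶ _⊑_ ⟶ _⊑_ → DirectedFamily f → DirectedFamily g →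
    DirectedFamily (λ (ij : I × J) → f (proj₁ ij) ∙ g (proj₂ ij))
  DirectedFamily-zipWith mono (i₀ , boundedᶠ) (j₀ , boundedᵍ) =
    (i₀ , j₀) , λ (i , j) (i' , j') →
      let (k , fi⊑fk , fi'⊑fk) = boundedᶠ i i'
          (l , gj⊑gl , gj'⊑gl) = boundedᵍ j j'
      in (k , l) , mono fi⊑fk gj⊑gl , mono fi'⊑fk gj'⊑gl

  ⨆ᶠ∈𝒟 : ∀ {R} {I : Set} {f : I → Pair} →
         DirectedFamily f → (∀ i → R (f i)) → 𝒟 R (⨆ᶠ f)
  ⨆ᶠ∈𝒟 {f = f} directed f∈R =
    range f , (λ { (i , refl) → f∈R i }) , range-directed directed , sym (⨆-range f)

  PreservesNonemptyJoins₂ : (Pair → Pair → Pair) → Set₁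
  PreservesNonemptyJoins₂ _∙_ = ∀ {I J : Set} (f : I → Pair) (g : J → Pair) → I → J →
    ⨆ᶠ f ∙ ⨆ᶠ g ≡ ⨆ᶠ (λ (ij : I × J) → f (proj₁ ij) ∙ g (proj₂ ij))

  ⋏-preservesNonemptyJoins : PreservesNonemptyJoins₂ _⋏_
  ⋏-preservesNonemptyJoins f g i₀ j₀ =
    cong₂ _,_ (P.⋁-∧-⋁ _ _) (N.⋁-∨-⋁ _ _ i₀ j₀)

  ⋎-preservesNonemptyJoins : PreservesNonemptyJoins₂ _⋎_
  ⋎-preservesNonemptyJoins f g i₀ j₀ =
    cong₂ _,_ (P.⋁-∨-⋁ _ _ i₀ j₀) (N.⋁-∧-⋁ _ _)

  𝒟-closedUnder : ∀ {_∙_} → _∙_ Preserves₂ _⊑_ ⟶ _⊑_ ⟶ _⊑_ → PreservesNonemptyJoins₂ _∙_ →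
                  ∀ {R} → ClosedUnder _∙_ R → ClosedUnder _∙_ (𝒟 R)
  𝒟-closedUnder {_∙_} mono preserves {R} closed _ _
    (A , A⊆R , dirA , refl) (B , B⊆R , dirB , refl) =
    subst (𝒟 R) (sym (preserves proj₁ proj₁ (proj₁ dirA) (proj₁ dirB)))
      (⨆ᶠ∈𝒟 (DirectedFamily-zipWith mono (Directed⇒DirectedFamily dirA)
                                         (Directed⇒DirectedFamily dirB))
             λ ((α , Aα) , (β , Bβ)) → closed α β (A⊆R Aα) (B⊆R Bβ))

  ⊑⨆ᶠ⇒≡⨆ᶠ-⊓ : {I : Set} {f : I → Pair} {α : Pair} → α ⊑ ⨆ᶠ f → α ≡ ⨆ᶠ (λ i → f i ⊓ α)
  ⊑⨆ᶠ⇒≡⨆ᶠ-⊓ (p₊ , p₋) = cong₂ _,_ (P.≤⋁⇒≡⋁-∧ _ p₊) (N.≤⋁⇒≡⋁-∧ _ p₋)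

  𝒟-downClosed : ∀ {R} → DownClosed R → DownClosed (𝒟 R)
  𝒟-downClosed {R} downClosed α _ α⊑⨆A (A , A⊆R , dirA , refl) =
    subst (𝒟 R) (sym (⊑⨆ᶠ⇒≡⨆ᶠ-⊓ α⊑⨆A))
      (⨆ᶠ∈𝒟 (DirectedFamily-map (⊓-monotonicˡ α) (Directed⇒DirectedFamily dirA))
             λ (γ , Aγ) → downClosed (γ ⊓ α) γ (α⊓β⊑α γ α) (A⊆R Aγ))

  module _ {ℓ} {R : Pred Pair ℓ} where

    logicClosed⇒⋏-closed : LogicClosed R → ClosedUnder _⋏_ R
    logicClosed⇒⋏-closed closed α β Rα Rβ = proj₁ (closed α β Rα Rβ)

    logicClosed⇒⋎-closed : LogicClosed R → ClosedUnder _⋎_ R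
    logicClosed⇒⋎-closed closed α β Rα Rβ = proj₂ (closed α β Rα Rβ)

    ⋏⋎-closed⇒logicClosed : ClosedUnder _⋏_ R → ClosedUnder _⋎_ R → LogicClosed R
    ⋏⋎-closed⇒logicClosed ⋏-closed ⋎-closed α β Rα Rβ = ⋏-closed α β Rα Rβ , ⋎-closed α β Rα Rβ

  module _ {R : Pred Pair zero} (closed : LogicClosed R) where

    ↓-logicClosed : LogicClosed (↓ R)
    ↓-logicClosed = ⋏⋎-closed⇒logicClosed
      (↓-closedUnder ⋏-monotonic (logicClosed⇒⋏-closed closed))
      (↓-closedUnder ⋎-monotonic (logicClosed⇒⋎-closed closed))

    ↑-logicClosed : LogicClosed (↑ R)
    ↑-logicClosed = ⋏⋎-closed⇒logicClosed
      (↑-closedUnder ⋏-monotonic (logicClosed⇒⋏-closed closed))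
      (↑-closedUnder ⋎-monotonic (logicClosed⇒⋎-closed closed))

    𝒟-logicClosed : LogicClosed (𝒟 R)
    𝒟-logicClosed = ⋏⋎-closed⇒logicClosed
      (𝒟-closedUnder ⋏-monotonic ⋏-preservesNonemptyJoins (logicClosed⇒⋏-closed closed))
      (𝒟-closedUnder ⋎-monotonic ⋎-preservesNonemptyJoins (logicClosed⇒⋎-closed closed))

lemma5 : (L₊ L₋ : Frame) → let open Bilattice L₊ L₋ in (R : Pred Pair zero) →
    (LogicClosed R → LogicClosed (↓ R) × LogicClosed (↑ R)) ×
    (LogicClosed R → LogicClosed (𝒟 R)) ×
    (DownClosed R → DownClosed (𝒟 R))
lemma5 L₊ L₋ R =
  (λ closed → ↓-logicClosed closed , ↑-logicClosed closed) ,
  𝒟-logicClosed ,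
  𝒟-downClosed
  where open BilatticeProperties L₊ L₋
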